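{- For every integer $b\geq 2$, no number is a Trott number in both base $b$ and base $b+1$; that is, $T_b\cap T_{b+1}=\emptyset$.
   Context: A real number $x$ is a Trott number in base $b$ if $x\in(0,1)$ has an infinite continued fraction expansion $x=[0;a_1,a_2,\dots]$ with all $a_i$ positive integers and the base-$b$ expansion of $x$ is $(0.\hat{a}_1\hat{a}_2\hat{a}_3\dots)_b$, where $\hat{a}_i$ is the string of base-$b$ digits of $a_i$ (without leading zeros), concatenated. $T_b$ is the set of Trott numbers in base $b$. -}

module Defs where

open import Data.Nat as ℕ using (ℕ; zero; suc; _+_; _*_; _∸_; _^_; _≤_; _%_; _/_)
open import Data.Integer using (+_)
open import Data.Rational.Unnormalised using (ℚᵘ; mkℚᵘ; _-_; ∣_∣; _<_; 0ℚᵘ)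
open import Data.List using (List; []; _∷_; reverse; concatMap; map; upTo; foldl; length)
open import Data.Product using (_×_; _,_; ∃-syntax)

-- Rational p / d, encoded as mkℚᵘ p (d ∸ 1); correct whenever d ≥ 1,
-- which holds at every use below (convergent denominators q_n ≥ 1 for
-- positive partial quotients, and powers b^k with b ≥ 2).
frac : ℕ → ℕ → ℚᵘ
frac p d = mkℚᵘ (+ p) (d ∸ 1)

-- Continued fractions.  A sequence of partial quotients is a : ℕ → ℕ,
-- with a i standing for a_{i+1}, i.e. x = [0; a 0, a 1, a 2, …].

pq : (ℕ → ℕ) → ℕ → (ℕ × ℕ) × (ℕ × ℕ)
pq a zero = (0 , 1) , (1 , 0)
pq a (suc n) with pq a n
... | (p , q) , (p' , q') = (a n * p + p' , a n * q + q') , (p , q)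

convergent : (ℕ → ℕ) → ℕ → ℚᵘ
convergent a n with pq a n
... | (p , q) , _ = frac p q

-- Base-b digits of n, least significant first (fuel-bounded; fuel n
-- suffices for b ≥ 2).  Gives [] for n = 0.
digitsRevFuel : (b : ℕ) .{{_ : ℕ.NonZero b}} → ℕ → ℕ → List ℕ
digitsRevFuel b zero    n       = []
digitsRevFuel b (suc f) zero    = []
digitsRevFuel b (suc f) (suc n) = (suc n % b) ∷ digitsRevFuel b f (suc n / b)

digits : (b : ℕ) .{{_ : ℕ.NonZero b}} → ℕ → List ℕ
digits b n = reverse (digitsRevFuel b n n)

concatDigits : (b : ℕ) .{{_ : ℕ.NonZero b}} → (ℕ → ℕ) → ℕ → List ℕ
concatDigits b a n = concatMap (λ i → digits b (a i)) (upTo n)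

fracValue : ℕ → List ℕ → ℚᵘ
fracValue b ds = frac (foldl (λ acc d → acc * b + d) 0 ds) (b ^ length ds)

baseApprox : (b : ℕ) .{{_ : ℕ.NonZero b}} → (ℕ → ℕ) → ℕ → ℚᵘ
baseApprox b a n = fracValue b (concatDigits b a n)

SameLimit : (ℕ → ℚᵘ) → (ℕ → ℚᵘ) → Set
SameLimit s t = ∀ (ε : ℚᵘ) → 0ℚᵘ < ε →
  ∃[ N ] ∀ n → N ≤ n → ∣ s n - t n ∣ < ε

Positive : (ℕ → ℕ) → Set
Positive a = ∀ i → 1 ≤ a i

-- The number x = [0; a_1, a_2, …] (limit of convergents) is a Trott
-- number in base b: its a_i are positive integers and x equals
-- (0.â_1 â_2 â_3 …)_b (limit of the truncations).
IsTrottCF : (b : ℕ) .{{_ : ℕ.NonZero b}} → (ℕ → ℕ) → Set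
IsTrottCF b a = Positive a × SameLimit (convergent a) (baseApprox b a)

{-# OPTIONS --safe #-}
-- Let x = [0; c, A, …] be a Trott number in the bases b and b + 1. Comparing convergents
-- with each other shows that both continued fractions start with the same c and A, and each
-- base expansion of x starts with the digits of c followed by those of A. Squeezing x between
-- the interval cut out by c and A and the two digit intervals forces c to be a single digit
-- with b = c² + d, d ≥ 1, and the digit block of A to be longer in base b than in base b + 1:
-- (b + 1)^m′ < b^m. The same inequalities make the excesses E = d b^m - c A and
-- E′ = (d + 1) (b + 1)^m′ - c A less than a few multiples of b. Reducing the identity
-- (d + 1) (b + 1)^m′ + E = d b^m + E′ modulo b determines E′ - E up to a multiple j ≤ 2 of b,
-- and then modulo b + 1, where b ≡ -1, it leaves a nonzero remainder below b + 1. The case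
-- b = 2 (c = d = 1) is a direct inequality.
module Submission where

open import Defs
open import Data.Nat as ℕ using (ℕ; zero; suc; _+_; _*_; _∸_; _^_; _≤_; _≰_; _<_; _%_; _/_; z≤n; s≤s; NonZero)
open import Data.Nat.Properties
open import Data.Nat.DivMod using (m≡m%n+[m/n]*n; m%n<n; m/n<m)
open import Data.Nat.Divisibility using (_∣_; >⇒∤; ∣m+n∣m⇒∣n; m∣m*n)
open import Data.Nat.Tactic.RingSolver using (solve-∀)
import Data.Integer as ℤ
import Data.Integer.Properties as ℤ
import Data.Rational.Unnormalised as ℚ
import Data.Rational.Unnormalised.Properties as ℚ
open import Relation.Nullary using (yes; no; contradiction)
open import Data.List using (List; []; _∷_; reverse; concat; map; applyUpTo; foldl; length; _++_)
open import Data.List.Properties using (foldl-++; unfold-reverse; length-reverse; length-++)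
open import Data.Product using (_×_; _,_; proj₁; proj₂; ∃-syntax)
open import Data.Sum using (_⊎_; inj₁; inj₂; [_,_]′)
open import Data.Empty using (⊥)
open import Relation.Binary.PropositionalEquality

m+o≡n⇒m≤n : ∀ {m n} o → m + o ≡ n → m ≤ n
m+o≡n⇒m≤n {m} o eq = subst (m ≤_) eq (m≤m+n m o)

≤-from-balance : ∀ {L R} x y → L + y ≡ R + x → x ≤ y → L ≤ R
≤-from-balance {L} {R} x y eq x≤y = +-cancelʳ-≤ y L R (≤-trans (≤-reflexive eq) (+-monoʳ-≤ R x≤y))

m<n⇒n≡m+o : ∀ {m n} → m < n → ∃[ o ] (1 ≤ o × n ≡ m + o)
m<n⇒n≡m+o {m} m<n with m≤n⇒∃[o]m+o≡n m<n
... | o , eq = suc o , s≤s z≤n , sym (trans (+-suc m o) eq)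

excess⇒≰ : ∀ {L R} S → L ≡ R + suc S → L ≰ R
excess⇒≰ {L} {R} S eq L≤R = m+1+n≰m R (subst (_≤ R) eq L≤R)

-- Polynomial inequalities are refuted by exhibiting the excess S of one side over the other
-- as an explicit polynomial with natural coefficients; solve-∀ checks the identity.
excess⇒≰′ : ∀ {L R K K′} S → K ≡ K′ → L + K ≡ R + K′ + suc S → L ≰ R
excess⇒≰′ {L} {R} {K} S refl eq = excess⇒≰ S (+-cancelʳ-≡ K _ _ (trans eq (regroup R K S)))
  where
    regroup : ∀ R K S → R + K + suc S ≡ R + suc S + K
    regroup = solve-∀

excess⇒≢ : ∀ {K K′} S → K ≡ K′ → K ≢ K′ + suc S
excess⇒≢ {K′ = K′} S refl eq = m+1+n≰m K′ (≤-reflexive (sym eq))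

fromDigits : ℕ → List ℕ → ℕ
fromDigits b = foldl (λ acc d → acc * b + d) 0

foldl-fromDigits : ∀ b acc ds →
  foldl (λ acc d → acc * b + d) acc ds ≡ acc * b ^ length ds + fromDigits b ds
foldl-fromDigits b acc [] = sym (trans (+-identityʳ _) (*-identityʳ acc))
foldl-fromDigits b acc (d ∷ ds) = begin
    foldl step (acc * b + d) ds                   ≡⟨ foldl-fromDigits b (acc * b + d) ds ⟩
    (acc * b + d) * b ^ length ds + fromDigits b ds ≡⟨ regroup acc b d (b ^ length ds) (fromDigits b ds) ⟩
    acc * (b * b ^ length ds) + (d * b ^ length ds + fromDigits b ds)
      ≡⟨ cong (acc * (b * b ^ length ds) +_) (foldl-fromDigits b d ds) ⟨
    acc * (b * b ^ length ds) + foldl step d ds   ∎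
  where
    open ≡-Reasoning
    step = λ acc d → acc * b + d
    regroup : ∀ acc b d W V → (acc * b + d) * W + V ≡ acc * (b * W) + (d * W + V)
    regroup = solve-∀

fromDigits-++ : ∀ b xs ys → fromDigits b (xs ++ ys) ≡ fromDigits b xs * b ^ length ys + fromDigits b ys
fromDigits-++ b xs ys = trans (foldl-++ _ 0 xs ys) (foldl-fromDigits b (fromDigits b xs) ys)

fromDigitsʳ : ℕ → List ℕ → ℕ
fromDigitsʳ b []       = 0
fromDigitsʳ b (d ∷ ds) = d + b * fromDigitsʳ b ds

fromDigits-reverse : ∀ b ds → fromDigits b (reverse ds) ≡ fromDigitsʳ b ds
fromDigits-reverse b []       = refl
fromDigits-reverse b (d ∷ ds) = begin
    fromDigits b (reverse (d ∷ ds))           ≡⟨ cong (fromDigits b) (unfold-reverse d ds) ⟩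
    fromDigits b (reverse ds ++ d ∷ [])       ≡⟨ fromDigits-++ b (reverse ds) (d ∷ []) ⟩
    fromDigits b (reverse ds) * (b * 1) + d   ≡⟨ cong (λ v → v * (b * 1) + d) (fromDigits-reverse b ds) ⟩
    fromDigitsʳ b ds * (b * 1) + d            ≡⟨ swap d b (fromDigitsʳ b ds) ⟩
    d + b * fromDigitsʳ b ds                  ∎
  where
    open ≡-Reasoning
    swap : ∀ d b v → v * (b * 1) + d ≡ d + b * v
    swap = solve-∀

module _ {b : ℕ} .{{_ : NonZero b}} (1<b : 1 < b) where

  private
    quotient≤fuel : ∀ {f} n → n ≤ f → suc n / b ≤ f
    quotient≤fuel n n≤f = ≤-trans (≤-pred (m/n<m (suc n) b 1<b)) n≤f

  fromDigitsʳ-digitsRevFuel : ∀ f n → n ≤ f → fromDigitsʳ b (digitsRevFuel b f n) ≡ n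
  fromDigitsʳ-digitsRevFuel zero    zero    _         = refl
  fromDigitsʳ-digitsRevFuel (suc f) zero    _         = refl
  fromDigitsʳ-digitsRevFuel (suc f) (suc n) (s≤s n≤f) = begin
      suc n % b + b * fromDigitsʳ b (digitsRevFuel b f (suc n / b))
        ≡⟨ cong (λ v → suc n % b + b * v) (fromDigitsʳ-digitsRevFuel f (suc n / b) (quotient≤fuel n n≤f)) ⟩
      suc n % b + b * (suc n / b)     ≡⟨ cong (suc n % b +_) (*-comm b (suc n / b)) ⟩
      suc n % b + (suc n / b) * b     ≡⟨ m≡m%n+[m/n]*n (suc n) b ⟨
      suc n                           ∎
    where open ≡-Reasoning

  n<b^length-digitsRevFuel : ∀ f n → n ≤ f → n < b ^ length (digitsRevFuel b f n)
  n<b^length-digitsRevFuel zero    zero    _         = s≤s z≤n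
  n<b^length-digitsRevFuel (suc f) zero    _         = s≤s z≤n
  n<b^length-digitsRevFuel (suc f) (suc n) (s≤s n≤f) = begin-strict
      suc n                       ≡⟨ m≡m%n+[m/n]*n (suc n) b ⟩
      suc n % b + suc n / b * b   <⟨ +-monoˡ-< (suc n / b * b) (m%n<n (suc n) b) ⟩
      b + suc n / b * b           ≡⟨ regroup b (suc n / b) ⟩
      b * suc (suc n / b)         ≤⟨ *-monoʳ-≤ b (n<b^length-digitsRevFuel f (suc n / b) (quotient≤fuel n n≤f)) ⟩
      b * b ^ length (digitsRevFuel b f (suc n / b)) ∎
    where
      open ≤-Reasoning
      regroup : ∀ b q → b + q * b ≡ b * suc q
      regroup = solve-∀

  b^length-digitsRevFuel≤b*n : ∀ f n → n ≤ f → 1 ≤ n → b ^ length (digitsRevFuel b f n) ≤ b * n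
  b^length-digitsRevFuel≤b*n (suc f) (suc n) (s≤s n≤f) _ = *-monoʳ-≤ b (b^length≤suc-n f (suc n / b) (quotient≤fuel n n≤f) q*b≤n)
    where
      q*b≤n : suc n / b * b ≤ suc n
      q*b≤n = ≤-trans (m≤n+m _ (suc n % b)) (≤-reflexive (sym (m≡m%n+[m/n]*n (suc n) b)))
      b^length≤suc-n : ∀ f q → q ≤ f → q * b ≤ suc n → b ^ length (digitsRevFuel b f q) ≤ suc n
      b^length≤suc-n zero    zero    _   _ = s≤s z≤n
      b^length≤suc-n (suc f) zero    _   _ = s≤s z≤n
      b^length≤suc-n f       (suc q) q≤f h = ≤-trans (b^length-digitsRevFuel≤b*n f (suc q) q≤f (s≤s z≤n))
        (≤-trans (≤-reflexive (*-comm b (suc q))) h)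

  fromDigits-digits : ∀ n → fromDigits b (digits b n) ≡ n
  fromDigits-digits n = trans (fromDigits-reverse b (digitsRevFuel b n n)) (fromDigitsʳ-digitsRevFuel n n ≤-refl)

  n<b^length-digits : ∀ n → n < b ^ length (digits b n)
  n<b^length-digits n = subst (λ L → n < b ^ L) (sym (length-reverse (digitsRevFuel b n n)))
    (n<b^length-digitsRevFuel n n ≤-refl)

  b^length-digits≤b*n : ∀ n → 1 ≤ n → b ^ length (digits b n) ≤ b * n
  b^length-digits≤b*n n 1≤n = subst (λ L → b ^ L ≤ b * n) (sym (length-reverse (digitsRevFuel b n n)))
    (b^length-digitsRevFuel≤b*n n n ≤-refl 1≤n)

  fromDigits<b^length : ∀ (a : ℕ → ℕ) is →
    let ds = concat (map (λ i → digits b (a i)) is) in fromDigits b ds < b ^ length ds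
  fromDigits<b^length a []       = s≤s z≤n
  fromDigits<b^length a (i ∷ is) = begin-strict
      fromDigits b (X ++ Rs)                               ≡⟨ fromDigits-++ b X Rs ⟩
      fromDigits b X * b ^ length Rs + fromDigits b Rs      <⟨ +-monoʳ-< _ (fromDigits<b^length a is) ⟩
      fromDigits b X * b ^ length Rs + b ^ length Rs        ≡⟨ +-comm (fromDigits b X * b ^ length Rs) _ ⟩
      suc (fromDigits b X) * b ^ length Rs
        ≤⟨ *-monoˡ-≤ (b ^ length Rs) (subst (_< b ^ length X) (sym (fromDigits-digits (a i))) (n<b^length-digits (a i))) ⟩
      b ^ length X * b ^ length Rs                         ≡⟨ ^-distribˡ-+-* b (length X) (length Rs) ⟨
      b ^ (length X + length Rs)                           ≡⟨ cong (b ^_) (length-++ X) ⟨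
      b ^ length (X ++ Rs)                                 ∎
    where
      open ≤-Reasoning
      X = digits b (a i)
      Rs = concat (map (λ i → digits b (a i)) is)

  baseApprox-suc-suc : ∀ (a : ℕ → ℕ) n →
    let Y = digits b (a 1) ; R = concat (map (λ i → digits b (a i)) (applyUpTo (λ i → suc (suc i)) n)) in
    baseApprox b a (suc (suc n))
      ≡ frac ((a 0 * b ^ length Y + a 1) * b ^ length R + fromDigits b R)
             (b ^ length (digits b (a 0)) * (b ^ length Y * b ^ length R))
  baseApprox-suc-suc a n = cong₂ frac numerator denominator
    where
      open ≡-Reasoning
      X = digits b (a 0)
      Y = digits b (a 1)
      R = concat (map (λ i → digits b (a i)) (applyUpTo (λ i → suc (suc i)) n))
      regroup : ∀ x P W y r → x * (P * W) + (y * W + r) ≡ (x * P + y) * W + r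
      regroup = solve-∀
      numerator : fromDigits b (X ++ (Y ++ R)) ≡ (a 0 * b ^ length Y + a 1) * b ^ length R + fromDigits b R
      numerator = begin
          fromDigits b (X ++ (Y ++ R))
            ≡⟨ fromDigits-++ b X (Y ++ R) ⟩
          fromDigits b X * b ^ length (Y ++ R) + fromDigits b (Y ++ R)
            ≡⟨ cong₂ (λ u v → fromDigits b X * b ^ u + v) (length-++ Y) (fromDigits-++ b Y R) ⟩
          fromDigits b X * b ^ (length Y + length R) + (fromDigits b Y * b ^ length R + fromDigits b R)
            ≡⟨ cong (λ u → fromDigits b X * u + (fromDigits b Y * b ^ length R + fromDigits b R)) (^-distribˡ-+-* b (length Y) (length R)) ⟩
          fromDigits b X * (b ^ length Y * b ^ length R) + (fromDigits b Y * b ^ length R + fromDigits b R)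
            ≡⟨ regroup (fromDigits b X) (b ^ length Y) (b ^ length R) (fromDigits b Y) (fromDigits b R) ⟩
          (fromDigits b X * b ^ length Y + fromDigits b Y) * b ^ length R + fromDigits b R
            ≡⟨ cong₂ (λ x y → (x * b ^ length Y + y) * b ^ length R + fromDigits b R)
                     (fromDigits-digits (a 0)) (fromDigits-digits (a 1)) ⟩
          (a 0 * b ^ length Y + a 1) * b ^ length R + fromDigits b R ∎
      denominator : b ^ length (X ++ (Y ++ R)) ≡ b ^ length X * (b ^ length Y * b ^ length R)
      denominator = begin
          b ^ length (X ++ (Y ++ R))               ≡⟨ cong (b ^_) (trans (length-++ X) (cong (length X +_) (length-++ Y))) ⟩
          b ^ (length X + (length Y + length R))   ≡⟨ ^-distribˡ-+-* b (length X) _ ⟩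
          b ^ length X * b ^ (length Y + length R) ≡⟨ cong (b ^ length X *_) (^-distribˡ-+-* b (length Y) (length R)) ⟩
          b ^ length X * (b ^ length Y * b ^ length R) ∎

shift : (ℕ → ℕ) → (ℕ → ℕ)
shift a i = a (suc i)

numer : (ℕ → ℕ) → ℕ → ℕ
numer a n = proj₁ (proj₁ (pq a n))

denom : (ℕ → ℕ) → ℕ → ℕ
denom a n = proj₂ (proj₁ (pq a n))

-- [0; a₀, a₁, …] = 1 / (a₀ + [0; a₁, …]) at the level of the recurrences.
pq-suc : ∀ a n → pq a (suc n) ≡
  ((denom (shift a) n , a 0 * denom (shift a) n + numer (shift a) n) ,
   (proj₂ (proj₂ (pq (shift a) n)) , a 0 * proj₂ (proj₂ (pq (shift a) n)) + proj₁ (proj₂ (pq (shift a) n))))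
pq-suc a zero = cong₂ _,_ (cong₂ _,_ a₀*0+1≡1 refl) (cong (0 ,_) (sym a₀*0+1≡1))
  where
    a₀*0+1≡1 : a 0 * 0 + 1 ≡ 1
    a₀*0+1≡1 = cong (_+ 1) (*-zeroʳ (a 0))
pq-suc a (suc n) = trans (cong step (pq-suc a n))
    (cong₂ _,_ (cong (a (suc n) * q + q′ ,_) (regroup (a (suc n)) (a 0) q p q′ p′)) refl)
  where
    step : (ℕ × ℕ) × (ℕ × ℕ) → (ℕ × ℕ) × (ℕ × ℕ)
    step ((p , q) , (p′ , q′)) = (a (suc n) * p + p′ , a (suc n) * q + q′) , (p , q)
    p = numer (shift a) n
    q = denom (shift a) n
    p′ = proj₁ (proj₂ (pq (shift a) n))
    q′ = proj₂ (proj₂ (pq (shift a) n))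
    regroup : ∀ x c q p q′ p′ → x * (c * q + p) + (c * q′ + p′) ≡ c * (x * q + q′) + (x * p + p′)
    regroup = solve-∀

numer-suc : ∀ a n → numer a (suc n) ≡ denom (shift a) n
numer-suc a n = cong (λ r → proj₁ (proj₁ r)) (pq-suc a n)

denom-suc : ∀ a n → denom a (suc n) ≡ a 0 * denom (shift a) n + numer (shift a) n
denom-suc a n = cong (λ r → proj₂ (proj₁ r)) (pq-suc a n)

module _ {a : ℕ → ℕ} (pos : Positive a) where

  denom-shift≤denom-suc : ∀ n → denom (shift a) n ≤ denom a (suc n)
  denom-shift≤denom-suc n = subst (denom (shift a) n ≤_) (sym (denom-suc a n))
    (≤-trans (m≤n*m (denom (shift a) n) (a 0) ⦃ ℕ.>-nonZero (pos 0) ⦄) (m≤m+n _ _))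

  numer≤denom : ∀ n → numer a n ≤ denom a n
  numer≤denom zero    = z≤n
  numer≤denom (suc n) = subst (_≤ denom a (suc n)) (sym (numer-suc a n)) (denom-shift≤denom-suc n)

1≤denom : ∀ {a} → Positive a → ∀ n → 1 ≤ denom a n
1≤denom pos zero    = s≤s z≤n
1≤denom pos (suc n) = ≤-trans (1≤denom (λ i → pos (suc i)) n) (denom-shift≤denom-suc pos n)

-- For n ≥ 3 the n-th convergent is 1 / (c + 1 / (A + p/q)) with c = a₀, A = a₁ and p/q a
-- convergent of [0; a₂, a₃, …], so 1/s ≤ p/q ≤ 1 with s = a₂ + 1.
module _ {a : ℕ → ℕ} (pos : Positive a) (j : ℕ) where

  private
    c = a 0
    A = a 1
    s = a 2 + 1
    p = numer (shift (shift a)) (suc j)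
    q = denom (shift (shift a)) (suc j)

    numer-eq : numer a (3 + j) ≡ A * q + p
    numer-eq = trans (numer-suc a (2 + j)) (denom-suc (shift a) (1 + j))

    denom-eq : denom a (3 + j) ≡ c * (A * q + p) + q
    denom-eq = trans (denom-suc a (2 + j))
      (cong₂ (λ u v → c * u + v) (denom-suc (shift a) (1 + j)) (numer-suc (shift a) (1 + j)))

    p≤q : p ≤ q
    p≤q = numer≤denom (λ i → pos (2 + i)) (suc j)

    q≤s*p : q ≤ s * p
    q≤s*p = begin
        q                              ≡⟨ denom-suc (shift (shift a)) j ⟩
        a 2 * denom a₃ j + numer a₃ j  ≤⟨ +-monoʳ-≤ (a 2 * denom a₃ j) (numer≤denom (λ i → pos (3 + i)) j) ⟩
        a 2 * denom a₃ j + denom a₃ j  ≡⟨ cong (a 2 * denom a₃ j +_) (*-identityˡ (denom a₃ j)) ⟨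
        a 2 * denom a₃ j + 1 * denom a₃ j ≡⟨ *-distribʳ-+ (denom a₃ j) (a 2) 1 ⟨
        s * denom a₃ j                 ≡⟨ cong (s *_) (numer-suc (shift (shift a)) j) ⟨
        s * p                          ∎
      where
        open ≤-Reasoning
        a₃ = shift (shift (shift a))

    rewrite-convergent : ∀ (R : ℕ → ℕ → Set) → R (A * q + p) (c * (A * q + p) + q) → R (numer a (3 + j)) (denom a (3 + j))
    rewrite-convergent R = subst₂ R (sym numer-eq) (sym denom-eq)

  convergent-lower : A * denom a (3 + j) ≤ numer a (3 + j) * (c * A + 1)
  convergent-lower = rewrite-convergent (λ x y → A * y ≤ x * (c * A + 1))
    (m+o≡n⇒m≤n p (identity c A p q))
    where
      identity : ∀ c A p q → A * (c * (A * q + p) + q) + p ≡ (A * q + p) * (c * A + 1)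
      identity = solve-∀

  convergent-upper : numer a (3 + j) * (c * A + c + 1) ≤ (A + 1) * denom a (3 + j)
  convergent-upper = rewrite-convergent (λ x y → x * (c * A + c + 1) ≤ (A + 1) * y)
    (≤-from-balance p q (identity c A p q) p≤q)
    where
      identity : ∀ c A p q → (A * q + p) * (c * A + c + 1) + q ≡ (A + 1) * (c * (A * q + p) + q) + p
      identity = solve-∀

  convergent-lower-sharp : (A * s + 1) * denom a (3 + j) ≤ numer a (3 + j) * (c * (A * s + 1) + s)
  convergent-lower-sharp = rewrite-convergent (λ x y → (A * s + 1) * y ≤ x * (c * (A * s + 1) + s))
    (≤-from-balance q (s * p) (identity c A p q s) q≤s*p)
    where
      identity : ∀ c A p q s → (A * s + 1) * (c * (A * q + p) + q) + s * p ≡ (A * q + p) * (c * (A * s + 1) + s) + q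
      identity = solve-∀

leading-quotient-≤ : ∀ c c′ A A′ → 1 ≤ A →
  A * (c′ * A′ + c′ + 1) ≤ (A′ + 1) * (c * A + 1) → c′ ≤ c
leading-quotient-≤ c c′ (suc a) A′ _ H with c′ ≤? c
... | yes c′≤c = c′≤c
... | no  c′≰c with m≤n⇒∃[o]m+o≡n (≰⇒> c′≰c)
...   | t , refl = contradiction H
  (excess⇒≰ (A′ * a + A′ * a * t + A′ * t + 2 * a + a * t + t) (identity c t a A′))
  where
    identity : ∀ c t a A′ → suc a * ((suc c + t) * A′ + (suc c + t) + 1)
      ≡ (A′ + 1) * (c * suc a + 1) + suc (A′ * a + A′ * a * t + A′ * t + 2 * a + a * t + t)
    identity = solve-∀

second-quotient-≤ : ∀ c A A′ s′ →
  (A′ * s′ + 1) * (c * A + c + 1) ≤ (A + 1) * (c * (A′ * s′ + 1) + s′) → A′ ≤ A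
second-quotient-≤ c A A′ s′ H with A′ ≤? A
... | yes A′≤A = A′≤A
... | no  A′≰A with m≤n⇒∃[o]m+o≡n (≰⇒> A′≰A)
...   | t , refl = contradiction H (excess⇒≰ (s′ * t) (identity c A t s′))
  where
    identity : ∀ c A t s → ((suc A + t) * s + 1) * (c * A + c + 1)
      ≡ (A + 1) * (c * ((suc A + t) * s + 1) + s) + suc (s * t)
    identity = solve-∀

m≤n+∣m⊖n∣ : ∀ m n → m ≤ n + ℤ.∣ m ℤ.⊖ n ∣
m≤n+∣m⊖n∣ m n with m ≤? n
... | yes m≤n = ≤-trans m≤n (m≤m+n n _)
... | no  m≰n = ≤-reflexive (sym (begin
    n + ℤ.∣ m ℤ.⊖ n ∣ ≡⟨ cong (n +_) (trans (ℤ.∣m⊖n∣≡∣n⊖m∣ m n) (ℤ.∣⊖∣-≰ m≰n)) ⟩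
    n + (m ∸ n)       ≡⟨ m+[n∸m]≡n (<⇒≤ (≰⇒> m≰n)) ⟩
    m                 ∎))
  where open ≡-Reasoning

-- n₁ / q₁ ≤ n₂ / q₂ + k / M, with denominators cleared.
record LeWithin (M k n₁ q₁ n₂ q₂ : ℕ) : Set where
  constructor leWithin
  field cleared : n₁ * q₂ * M ≤ n₂ * q₁ * M + k * (q₁ * q₂)

LeWithin-trans : ∀ {M k l n₁ q₁ n₂ q₂ n₃ q₃} .{{_ : NonZero q₂}} →
  LeWithin M k n₁ q₁ n₂ q₂ → LeWithin M l n₂ q₂ n₃ q₃ → LeWithin M (k + l) n₁ q₁ n₃ q₃
LeWithin-trans {M} {k} {l} {n₁} {q₁} {n₂} {q₂} {n₃} {q₃} (leWithin H₁) (leWithin H₂) =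
  leWithin (*-cancelʳ-≤ _ _ q₂ (begin
    n₁ * q₃ * M * q₂                              ≡⟨ identity₁ n₁ q₂ q₃ M ⟩
    n₁ * q₂ * M * q₃                              ≤⟨ *-monoˡ-≤ q₃ H₁ ⟩
    (n₂ * q₁ * M + k * (q₁ * q₂)) * q₃            ≡⟨ identity₂ n₂ q₁ q₂ q₃ M k ⟩
    q₁ * (n₂ * q₃ * M) + k * (q₁ * q₂) * q₃       ≤⟨ +-monoˡ-≤ _ (*-monoʳ-≤ q₁ H₂) ⟩
    q₁ * (n₃ * q₂ * M + l * (q₂ * q₃)) + k * (q₁ * q₂) * q₃ ≡⟨ identity₃ n₃ q₁ q₂ q₃ M k l ⟩
    (n₃ * q₁ * M + (k + l) * (q₁ * q₃)) * q₂      ∎))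
  where
    open ≤-Reasoning
    identity₁ : ∀ n₁ q₂ q₃ M → n₁ * q₃ * M * q₂ ≡ n₁ * q₂ * M * q₃
    identity₁ = solve-∀
    identity₂ : ∀ n₂ q₁ q₂ q₃ M k → (n₂ * q₁ * M + k * (q₁ * q₂)) * q₃ ≡ q₁ * (n₂ * q₃ * M) + k * (q₁ * q₂) * q₃
    identity₂ = solve-∀
    identity₃ : ∀ n₃ q₁ q₂ q₃ M k l →
      q₁ * (n₃ * q₂ * M + l * (q₂ * q₃)) + k * (q₁ * q₂) * q₃ ≡ (n₃ * q₁ * M + (k + l) * (q₁ * q₃)) * q₂
    identity₃ = solve-∀

-- If l/q ≤ n₁/q₁ ≤ n₂/q₂ + k/M ≤ h/q′ + k/M and k/M < 1/(q q′), then l/q ≤ h/q′,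
-- since both sides are fractions with denominator dividing q q′.
LeWithin-squeeze : ∀ {M k l q n₁ q₁ n₂ q₂ h q′} .{{_ : NonZero q₁}} .{{_ : NonZero q₂}} →
  l * q₁ ≤ n₁ * q → LeWithin M k n₁ q₁ n₂ q₂ → n₂ * q′ ≤ h * q₂ → k * (q * q′) < M → l * q′ ≤ h * q
LeWithin-squeeze {M} {k} {l} {q} {n₁} {q₁} {n₂} {q₂} {h} {q′} lower (leWithin H) upper small =
  ≤-pred (*-cancelʳ-< M (l * q′) (suc (h * q)) (begin-strict
    l * q′ * M                   ≤⟨ cleared ⟩
    h * q * M + k * (q * q′)     <⟨ +-monoʳ-< (h * q * M) small ⟩
    h * q * M + M                ≡⟨ identity₅ h q M ⟩
    suc (h * q) * M              ∎))
  where
    open ≤-Reasoning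
    instance
      q₁q₂≢0 : NonZero (q₁ * q₂)
      q₁q₂≢0 = m*n≢0 q₁ q₂
    identity₁ : ∀ l q₁ q₂ M q′ q → l * q′ * M * (q₁ * q₂) ≡ l * q₁ * (q₂ * M * q′)
    identity₁ = solve-∀
    identity₂ : ∀ n₁ q q₂ M q′ → n₁ * q * (q₂ * M * q′) ≡ n₁ * q₂ * M * (q * q′)
    identity₂ = solve-∀
    identity₃ : ∀ n₂ q₁ q₂ M k q q′ →
      (n₂ * q₁ * M + k * (q₁ * q₂)) * (q * q′) ≡ q₁ * q * M * (n₂ * q′) + k * (q₁ * q₂) * (q * q′)
    identity₃ = solve-∀
    identity₄ : ∀ h q₁ q₂ M k q q′ →
      q₁ * q * M * (h * q₂) + k * (q₁ * q₂) * (q * q′) ≡ (h * q * M + k * (q * q′)) * (q₁ * q₂)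
    identity₄ = solve-∀
    identity₅ : ∀ h q M → h * q * M + M ≡ suc (h * q) * M
    identity₅ = solve-∀
    cleared : l * q′ * M ≤ h * q * M + k * (q * q′)
    cleared = *-cancelʳ-≤ _ _ (q₁ * q₂) (begin
      l * q′ * M * (q₁ * q₂)                          ≡⟨ identity₁ l q₁ q₂ M q′ q ⟩
      l * q₁ * (q₂ * M * q′)                          ≤⟨ *-monoˡ-≤ (q₂ * M * q′) lower ⟩
      n₁ * q * (q₂ * M * q′)                          ≡⟨ identity₂ n₁ q q₂ M q′ ⟩
      n₁ * q₂ * M * (q * q′)                          ≤⟨ *-monoˡ-≤ (q * q′) H ⟩
      (n₂ * q₁ * M + k * (q₁ * q₂)) * (q * q′)        ≡⟨ identity₃ n₂ q₁ q₂ M k q q′ ⟩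
      q₁ * q * M * (n₂ * q′) + k * (q₁ * q₂) * (q * q′) ≤⟨ +-monoˡ-≤ _ (*-monoʳ-≤ (q₁ * q * M) upper) ⟩
      q₁ * q * M * (h * q₂) + k * (q₁ * q₂) * (q * q′)  ≡⟨ identity₄ h q₁ q₂ M k q q′ ⟩
      (h * q * M + k * (q * q′)) * (q₁ * q₂)          ∎)

frac-close⇒LeWithin : ∀ p₁ q₁ p₂ q₂ M →
  ℚ.∣ frac p₁ (suc q₁) ℚ.- frac p₂ (suc q₂) ∣ ℚ.< frac 1 (suc M) →
  LeWithin (suc M) 1 p₁ (suc q₁) p₂ (suc q₂)
frac-close⇒LeWithin p₁ q₁ p₂ q₂ M (ℚ.*<* h) = leWithin (begin
    X * suc M                          ≤⟨ *-monoˡ-≤ (suc M) (m≤n+∣m⊖n∣ X Y) ⟩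
    (Y + D) * suc M                    ≡⟨ *-distribʳ-+ (suc M) Y D ⟩
    Y * suc M + D * suc M              ≤⟨ +-monoʳ-≤ (Y * suc M) (<⇒≤ D*M<q₁q₂) ⟩
    Y * suc M + suc q₁ * suc q₂        ≡⟨ cong (Y * suc M +_) (*-identityˡ _) ⟨
    Y * suc M + 1 * (suc q₁ * suc q₂)  ∎)
  where
    open ≤-Reasoning
    X = p₁ * suc q₂
    Y = p₂ * suc q₁
    D = ℤ.∣ X ℤ.⊖ Y ∣
    n = ℤ.+ p₁ ℤ.* ℤ.+ suc q₂ ℤ.+ (ℤ.- ℤ.+ p₂) ℤ.* ℤ.+ suc q₁
    numerator≡ : n ≡ X ℤ.⊖ Y
    numerator≡ = trans (cong₂ ℤ._+_ (sym (ℤ.pos-* p₁ (suc q₂)))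
                                    (trans (sym (ℤ.neg-distribˡ-* (ℤ.+ p₂) (ℤ.+ suc q₁)))
                                           (cong ℤ.-_ (sym (ℤ.pos-* p₂ (suc q₁))))))
                       (ℤ.m-n≡m⊖n X Y)
    D*M<q₁q₂ : D * suc M < suc q₁ * suc q₂
    D*M<q₁q₂ = subst₂ _<_
      (cong (λ z → ℤ.∣ z ∣ * suc M) numerator≡) (+-identityʳ _)
      (ℤ.drop‿+<+ (subst₂ ℤ._<_ (sym (ℤ.pos-* ℤ.∣ n ∣ (suc M))) (sym (ℤ.pos-* 1 (suc q₁ * suc q₂))) h))

∣p-q∣≡∣q-p∣ : ∀ p q → ℚ.∣ p ℚ.- q ∣ ≡ ℚ.∣ q ℚ.- p ∣
∣p-q∣≡∣q-p∣ p q = begin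
    ℚ.∣ p ℚ.- q ∣                   ≡⟨ ℚ.∣-p∣≡∣p∣ (p ℚ.- q) ⟨
    ℚ.∣ ℚ.- (p ℚ.- q) ∣             ≡⟨ cong ℚ.∣_∣ (ℚ.neg-distrib-+ p (ℚ.- q)) ⟩
    ℚ.∣ ℚ.- p ℚ.+ ℚ.- (ℚ.- q) ∣     ≡⟨ cong (λ z → ℚ.∣ ℚ.- p ℚ.+ z ∣) (ℚ.neg-involutive-≡ q) ⟩
    ℚ.∣ ℚ.- p ℚ.+ q ∣               ≡⟨ cong ℚ.∣_∣ (ℚ.+-comm-≡ (ℚ.- p) q) ⟩
    ℚ.∣ q ℚ.- p ∣                   ∎
  where open ≡-Reasoning

SameLimit-sym : ∀ {s t} → SameLimit s t → SameLimit t s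
SameLimit-sym {s} {t} st ε ε>0 with st ε ε>0
... | N , close = N , λ n N≤n → subst (ℚ._< ε) (∣p-q∣≡∣q-p∣ (s n) (t n)) (close n N≤n)

-- The offset 3 is where convergents take the form used in convergent-lower and -upper.
record Fractions (s : ℕ → ℚ.ℚᵘ) : Set where
  field
    num den      : ℕ → ℕ
    s≡num/den    : ∀ j → s (3 + j) ≡ frac (num j) (den j)
    den-positive : ∀ j → 1 ≤ den j

open Fractions

module _ {s t : ℕ → ℚ.ℚᵘ} where

  record EventuallyLe (k : ℕ) (S : Fractions s) (T : Fractions t) : Set where
    constructor eventuallyLe
    field
      within : ∀ M → ∃[ N ] ∀ j → N ≤ j → LeWithin (suc M) k (num S j) (den S j) (num T j) (den T j)

  SameLimit⇒EventuallyLe : SameLimit s t → (S : Fractions s) (T : Fractions t) → EventuallyLe 1 S T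
  SameLimit⇒EventuallyLe st S T = eventuallyLe within
    where
      close⇒LeWithin : ∀ M p₁ q₁ p₂ q₂ → 1 ≤ q₁ → 1 ≤ q₂ →
        ℚ.∣ frac p₁ q₁ ℚ.- frac p₂ q₂ ∣ ℚ.< frac 1 (suc M) → LeWithin (suc M) 1 p₁ q₁ p₂ q₂
      close⇒LeWithin M p₁ (suc q₁) p₂ (suc q₂) _ _ = frac-close⇒LeWithin p₁ q₁ p₂ q₂ M
      within : ∀ M → ∃[ N ] ∀ j → N ≤ j → LeWithin (suc M) 1 (num S j) (den S j) (num T j) (den T j)
      within M with st (frac 1 (suc M)) (ℚ.*<* (ℤ.+<+ (s≤s z≤n)))
      ... | N , close = N , λ j N≤j →
        close⇒LeWithin M (num S j) (den S j) (num T j) (den T j) (den-positive S j) (den-positive T j)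
          (subst₂ (λ x y → ℚ.∣ x ℚ.- y ∣ ℚ.< frac 1 (suc M)) (s≡num/den S j) (s≡num/den T j)
                  (close (3 + j) (≤-trans N≤j (m≤n+m j 3))))

  EventuallyLe⇒≤ : ∀ {k} {S : Fractions s} {T : Fractions t} → EventuallyLe k S T → ∀ l q h q′ →
    (∀ j → l * den S j ≤ num S j * q) → (∀ j → num T j * q′ ≤ h * den T j) → l * q′ ≤ h * q
  EventuallyLe⇒≤ {k} {S} {T} (eventuallyLe within) l q h q′ lower upper with within (k * (q * q′))
  ... | N , close = LeWithin-squeeze {l = l} {h = h} ⦃ ℕ.>-nonZero (den-positive S N) ⦄ ⦃ ℕ.>-nonZero (den-positive T N) ⦄
    (lower N) (close N ≤-refl) (upper N) ≤-refl

EventuallyLe-trans : ∀ {s t u k l} {S : Fractions s} {T : Fractions t} {U : Fractions u} →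
  EventuallyLe k S T → EventuallyLe l T U → EventuallyLe (k + l) S U
EventuallyLe-trans {k = k} {l} {S} {T} {U} (eventuallyLe st) (eventuallyLe tu) = eventuallyLe within
  where
    within : ∀ M → ∃[ N ] ∀ j → N ≤ j → LeWithin (suc M) (k + l) (num S j) (den S j) (num U j) (den U j)
    within M with st M | tu M
    ... | N₁ , close₁ | N₂ , close₂ = N₁ + N₂ , λ j N≤j →
      LeWithin-trans ⦃ ℕ.>-nonZero (den-positive T j) ⦄
        (close₁ j (≤-trans (m≤m+n N₁ N₂) N≤j)) (close₂ j (≤-trans (m≤n+m N₂ N₁) N≤j))

SameLimit⇒≤ : ∀ {s t} → SameLimit s t → (S : Fractions s) (T : Fractions t) → ∀ l q h q′ →
  (∀ j → l * den S j ≤ num S j * q) → (∀ j → num T j * q′ ≤ h * den T j) → l * q′ ≤ h * q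
SameLimit⇒≤ st S T = EventuallyLe⇒≤ (SameLimit⇒EventuallyLe st S T)

-- Notation: x = [0; c, A, …], b = c * c + d is the smaller base, P = b ^ m and Q = (b + 1) ^ m′
-- are the scales of the digit block of A in the two bases, E = d P - c A and E′ = (d + 1) Q - c A.

cross-bound⇒Q<P : ∀ b c A P Q → 1 ≤ c → 1 ≤ A → suc b ≤ Q →
  (c * P + A) * (suc b * Q) ≤ (c * Q + A + 1) * (b * P) → Q < P
cross-bound⇒Q<P b (suc c) (suc a) P Q _ _ B≤Q H with P ≤? Q
... | no  P≰Q = ≰⇒> P≰Q
... | yes P≤Q with m≤n⇒∃[o]m+o≡n B≤Q | m≤n⇒∃[o]m+o≡n P≤Q
...   | u , refl | v , P+v≡Q = contradiction H (excess⇒≰′ S (cong (λ z → suc a * b * z) P+v≡Q) (identity c a b u v P))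
  where
    S = P + P * b * c + P * c + P * c * u + P * u + a + a * b + a * b * v + a * u + b + b * v + u
    identity : ∀ c a b u v P → (suc c * P + suc a) * (suc b * (suc b + u)) + suc a * b * (P + v)
      ≡ (suc c * (suc b + u) + suc a + 1) * (b * P) + suc a * b * (suc b + u)
        + suc (P + P * b * c + P * c + P * c * u + P * u + a + a * b + a * b * v + a * u + b + b * v + u)
    identity = solve-∀

A*B≤[c+1]*[cA+1] : ∀ B c A Q → A < Q → A * (B * Q) ≤ (c * Q + A + 1) * (c * A + 1) → A * B ≤ (c + 1) * (c * A + 1)
A*B≤[c+1]*[cA+1] B c A Q@(suc _) A<Q H = *-cancelʳ-≤ _ _ Q (begin
    A * B * Q                          ≡⟨ *-assoc A B Q ⟩
    A * (B * Q)                        ≤⟨ H ⟩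
    (c * Q + A + 1) * (c * A + 1)      ≡⟨ cong (_* (c * A + 1)) (+-assoc (c * Q) A 1) ⟩
    (c * Q + (A + 1)) * (c * A + 1)    ≤⟨ *-monoˡ-≤ (c * A + 1) (+-monoʳ-≤ (c * Q) (subst (_≤ Q) (+-comm 1 A) A<Q)) ⟩
    (c * Q + Q) * (c * A + 1)          ≡⟨ identity c Q A ⟩
    (c + 1) * (c * A + 1) * Q          ∎)
  where
    open ≤-Reasoning
    identity : ∀ c Q A → (c * Q + Q) * (c * A + 1) ≡ (c + 1) * (c * A + 1) * Q
    identity = solve-∀

2d+1≤3c : ∀ c d A → 2 ≤ A → A * (c * c + d + 1) ≤ (c + 1) * (c * A + 1) → 2 * d + 1 ≤ 3 * c
2d+1≤3c c d A 2≤A H with 2 * d + 1 ≤? 3 * c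
... | yes h = h
... | no  h with m≤n⇒∃[o]m+o≡n 2≤A | m≤n⇒∃[o]m+o≡n (≰⇒> h)
...   | a , refl | t , eqt = contradiction (*-monoʳ-≤ 2 H)
  (excess⇒≰′ (1 + 2 * a + a * c + a * t + 2 * t) (cong ((2 + a) *_) eqt) (identity c d a t))
  where
    identity : ∀ c d a t → 2 * ((2 + a) * (c * c + d + 1)) + (2 + a) * (suc (3 * c) + t)
      ≡ 2 * ((c + 1) * (c * (2 + a) + 1)) + (2 + a) * (2 * d + 1) + suc (1 + 2 * a + a * c + a * t + 2 * t)
    identity = solve-∀

cA<DR : ∀ c D A R → 1 ≤ A → (c * R + A) * (c * A + c + 1) ≤ (A + 1) * ((c * c + D) * R) → c * A < D * R
cA<DR c D (suc a) R _ H with c * suc a <? D * R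
... | yes h = h
... | no  h with m≤n⇒∃[o]m+o≡n (≮⇒≥ h)
...   | t , eqt = contradiction H
  (excess⇒≰′ (R * c + a + a * t + 2 * t) (cong ((suc a + 1) *_) eqt) (identity c D a R t))
  where
    identity : ∀ c D a R t → (c * R + suc a) * (c * suc a + c + 1) + (suc a + 1) * (D * R + t)
      ≡ (suc a + 1) * ((c * c + D) * R) + (suc a + 1) * (c * suc a) + suc (R * c + a + a * t + 2 * t)
    identity = solve-∀

excess-bound : ∀ c D A R E → A * ((c * c + D) * R) ≤ (c * R + A + 1) * (c * A + 1) → D * R ≡ c * A + E →
  D * A * E ≤ c * c * A + c * E + D * (c + 1) * A + D
excess-bound c D A R E H DR≡ = begin
    D * A * E                                ≡⟨ *-assoc D A E ⟩
    D * (A * E)                              ≤⟨ *-monoʳ-≤ D A*E≤ ⟩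
    D * (c * R + (c + 1) * A + 1)            ≡⟨ identity₄ c D A R ⟩
    c * (D * R) + D * (c + 1) * A + D        ≡⟨ cong (λ z → c * z + D * (c + 1) * A + D) DR≡ ⟩
    c * (c * A + E) + D * (c + 1) * A + D    ≡⟨ identity₅ c D A E ⟩
    c * c * A + c * E + D * (c + 1) * A + D  ∎
  where
    open ≤-Reasoning
    identity₁ : ∀ c D A R → A * ((c * c + D) * R) ≡ c * c * A * R + A * (D * R)
    identity₁ = solve-∀
    identity₂ : ∀ c A E R → c * c * A * R + A * (c * A + E) ≡ c * c * A * R + c * A * A + A * E
    identity₂ = solve-∀
    identity₃ : ∀ c A R → (c * R + A + 1) * (c * A + 1) ≡ c * c * A * R + c * A * A + (c * R + (c + 1) * A + 1)
    identity₃ = solve-∀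
    identity₄ : ∀ c D A R → D * (c * R + (c + 1) * A + 1) ≡ c * (D * R) + D * (c + 1) * A + D
    identity₄ = solve-∀
    identity₅ : ∀ c D A E → c * (c * A + E) + D * (c + 1) * A + D ≡ c * c * A + c * E + D * (c + 1) * A + D
    identity₅ = solve-∀
    A*E≤ : A * E ≤ c * R + (c + 1) * A + 1
    A*E≤ = +-cancelˡ-≤ (c * c * A * R + c * A * A) _ _ (begin
      c * c * A * R + c * A * A + A * E       ≡⟨ identity₂ c A E R ⟨
      c * c * A * R + A * (c * A + E)         ≡⟨ cong (λ z → c * c * A * R + A * z) DR≡ ⟨
      c * c * A * R + A * (D * R)             ≡⟨ identity₁ c D A R ⟨
      A * ((c * c + D) * R)                   ≤⟨ H ⟩
      (c * R + A + 1) * (c * A + 1)           ≡⟨ identity₃ c A R ⟩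
      c * c * A * R + c * A * A + (c * R + (c + 1) * A + 1) ∎)

¬cross-bound-base2 : ∀ A P Q → 1 ≤ A → A < Q → P ≤ 2 * A → (1 * P + A) * (3 * Q) ≤ (1 * Q + A + 1) * (2 * P) → ⊥
¬cross-bound-base2 (suc a0) P Q (s≤s z≤n) A<Q P≤2A H with m≤n⇒∃[o]m+o≡n A<Q | m≤n⇒∃[o]m+o≡n P≤2A
... | s , refl | t , eqt = excess⇒≰′ (1 + P * s + 3 * a0 + 3 * a0 * s + a0 * t + a0 * a0 + 3 * s + 2 * t)
        (cong (λ z → (suc a0 + 1) * z) eqt) (identity a0 P s t) H
  where
    identity : ∀ a0 P s t → (1 * P + suc a0) * (3 * (suc (suc a0) + s)) + (suc a0 + 1) * (P + t) ≡
        (1 * (suc (suc a0) + s) + suc a0 + 1) * (2 * P) + (suc a0 + 1) * (2 * suc a0) +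
        suc (1 + P * s + 3 * a0 + 3 * a0 * s + a0 * t + a0 * a0 + 3 * s + 2 * t)
    identity = solve-∀

E′≤b+d+1 : ∀ c d A E′ → 2 ≤ c → 1 ≤ d → c * c + d ≤ A →
  (d + 1) * A * E′ ≤ c * c * A + c * E′ + (d + 1) * (c + 1) * A + (d + 1) → E′ ≤ c * c + d + d + 1
E′≤b+d+1 (suc (suc c0)) (suc d0) A E′ (s≤s (s≤s z≤n)) (s≤s z≤n) hA H with E′ ≤? (suc (suc c0) * suc (suc c0) + suc d0 + suc d0 + 1)
... | yes h = h
... | no h with m≤n⇒∃[o]m+o≡n hA | m≤n⇒∃[o]m+o≡n (≰⇒> h)
...   | a , refl | e , refl = contradiction H (excess⇒≰ S (identity c0 d0 a e))
  where
    S = 11 + 6 * a + 2 * a * c0 + 3 * a * c0 * d0 + a * c0 * c0 + a * c0 * c0 * d0 + 9 * a * d0 + a * d0 * e + 2 * a * d0 * d0 + 2 * a * e + 18 * c0 + 51 * c0 * d0 + 4 * c0 * d0 * e + 11 * c0 * d0 * d0 + 7 * c0 * e + 13 * c0 * c0 + 27 * c0 * c0 * d0 + c0 * c0 * d0 * e + 3 * c0 * c0 * d0 * d0 + 2 * c0 * c0 * e + 5 * c0 * c0 * c0 + 7 * c0 * c0 * c0 * d0 + c0 * c0 * c0 * c0 + c0 * c0 * c0 * c0 * d0 + 46 * d0 + 7 * d0 * e + 19 * d0 * d0 + d0 * d0 * e + 2 * d0 * d0 * d0 + 8 * e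
    identity : ∀ c0 d0 a e →
      let c = suc (suc c0) ; d = suc d0 ; A = c * c + d + a ; E′ = suc (c * c + d + d + 1) + e in
      (d + 1) * A * E′ ≡ c * c * A + c * E′ + (d + 1) * (c + 1) * A + (d + 1) +
        suc (11 + 6 * a + 2 * a * c0 + 3 * a * c0 * d0 + a * c0 * c0 + a * c0 * c0 * d0 + 9 * a * d0 + a * d0 * e + 2 * a * d0 * d0 + 2 * a * e + 18 * c0 + 51 * c0 * d0 + 4 * c0 * d0 * e + 11 * c0 * d0 * d0 + 7 * c0 * e + 13 * c0 * c0 + 27 * c0 * c0 * d0 + c0 * c0 * d0 * e + 3 * c0 * c0 * d0 * d0 + 2 * c0 * c0 * e + 5 * c0 * c0 * c0 + 7 * c0 * c0 * c0 * d0 + c0 * c0 * c0 * c0 + c0 * c0 * c0 * c0 * d0 + 46 * d0 + 7 * d0 * e + 19 * d0 * d0 + d0 * d0 * e + 2 * d0 * d0 * d0 + 8 * e)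
    identity = solve-∀

E+d<3b : ∀ c d A E → 2 ≤ c → 1 ≤ d → c * c + d ≤ A →
  d * A * E ≤ c * c * A + c * E + d * (c + 1) * A + d → E + d < 3 * (c * c + d)
E+d<3b (suc (suc c0)) (suc d0) A E (s≤s (s≤s z≤n)) (s≤s z≤n) hA H with E + suc d0 <? 3 * (suc (suc c0) * suc (suc c0) + suc d0)
... | yes h = h
... | no h with m≤n⇒∃[o]m+o≡n hA | m≤n⇒∃[o]m+o≡n (≮⇒≥ h)
...   | a , refl | e , eqe = contradiction H
  (excess⇒≰ S (subst (λ E → d * A′ * E ≡ c * c * A′ + c * E + d * (c + 1) * A′ + d + suc S) Eeq (identity c0 d0 a e)))
  where
    c = suc (suc c0)
    d = suc d0
    A′ = c * c + d + a
    Eeq : 3 * c * c + 2 * d + e ≡ E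
    Eeq = +-cancelʳ-≡ d _ _ (trans (regroup c d e) eqe)
      where
        regroup : ∀ c d e → 3 * c * c + 2 * d + e + d ≡ 3 * (c * c + d) + e
        regroup = solve-∀
    S = 5 + 7 * a + 7 * a * c0 + 11 * a * c0 * d0 + 2 * a * c0 * c0 + 3 * a * c0 * c0 * d0 + 13 * a * d0 + a * d0 * e + 2 * a * d0 * d0 + a * e + 25 * c0 + 112 * c0 * d0 + 4 * c0 * d0 * e + 19 * c0 * d0 * d0 + 3 * c0 * e + 27 * c0 * c0 + 74 * c0 * c0 * d0 + c0 * c0 * d0 * e + 5 * c0 * c0 * d0 * d0 + c0 * c0 * e + 12 * c0 * c0 * c0 + 23 * c0 * c0 * c0 * d0 + 2 * c0 * c0 * c0 * c0 + 3 * c0 * c0 * c0 * c0 * d0 + 67 * d0 + 6 * d0 * e + 23 * d0 * d0 + d0 * d0 * e + 2 * d0 * d0 * d0 + 3 * e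
    identity : ∀ c0 d0 a e →
      let c = suc (suc c0) ; d = suc d0 ; A = c * c + d + a ; E = 3 * c * c + 2 * d + e in
      d * A * E ≡ c * c * A + c * E + d * (c + 1) * A + d +
        suc (5 + 7 * a + 7 * a * c0 + 11 * a * c0 * d0 + 2 * a * c0 * c0 + 3 * a * c0 * c0 * d0 + 13 * a * d0 + a * d0 * e + 2 * a * d0 * d0 + a * e + 25 * c0 + 112 * c0 * d0 + 4 * c0 * d0 * e + 19 * c0 * d0 * d0 + 3 * c0 * e + 27 * c0 * c0 + 74 * c0 * c0 * d0 + c0 * c0 * d0 * e + 5 * c0 * c0 * d0 * d0 + c0 * c0 * e + 12 * c0 * c0 * c0 + 23 * c0 * c0 * c0 * d0 + 2 * c0 * c0 * c0 * c0 + 3 * c0 * c0 * c0 * c0 * d0 + 67 * d0 + 6 * d0 * e + 23 * d0 * d0 + d0 * d0 * e + 2 * d0 * d0 * d0 + 3 * e)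
    identity = solve-∀

E+2<12 : ∀ A E → 6 ≤ A → 2 * A * E ≤ 2 * 2 * A + 2 * E + 2 * (2 + 1) * A + 2 → E + 2 < 2 * 6
E+2<12 A E 6≤A H with E ≤? 9
... | yes E≤9 = s≤s (+-monoˡ-≤ 2 E≤9)
... | no  E≰9 = contradiction H (<⇒≱ (begin-strict
    2 * 2 * A + 2 * E + 2 * (2 + 1) * A + 2  ≡⟨ identity₁ A E ⟩
    10 * A + 2 * E + 2                       <⟨ +-monoʳ-< (10 * A + 2 * E) 2<4E ⟩
    10 * A + 2 * E + 4 * E                   ≡⟨ identity₂ A E ⟩
    A * 10 + 6 * E                           ≤⟨ +-mono-≤ (*-monoʳ-≤ A 10≤E) (*-monoˡ-≤ E 6≤A) ⟩
    A * E + A * E                            ≡⟨ identity₃ A E ⟩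
    2 * A * E                                ∎))
  where
    open ≤-Reasoning
    10≤E : 10 ≤ E
    10≤E = ≰⇒> E≰9
    2<4E : 2 < 4 * E
    2<4E = ≤-trans (s≤s (s≤s (s≤s (z≤n {1})))) (*-monoʳ-≤ 4 (≤-trans (s≤s z≤n) 10≤E))
    identity₁ : ∀ A E → 2 * 2 * A + 2 * E + 2 * (2 + 1) * A + 2 ≡ 10 * A + 2 * E + 2
    identity₁ = solve-∀
    identity₂ : ∀ A E → 10 * A + 2 * E + 4 * E ≡ A * 10 + 6 * E
    identity₂ = solve-∀
    identity₃ : ∀ A E → A * E + A * E ≡ 2 * A * E
    identity₃ = solve-∀

c*c<P₁ : ∀ c A P P₁ → 1 ≤ c → 1 ≤ A → (c * P + A) * (c * A + c + 1) ≤ (A + 1) * (P₁ * P) → c * c < P₁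
c*c<P₁ (suc c0) (suc a0) P P₁ (s≤s z≤n) (s≤s z≤n) H with suc c0 * suc c0 <? P₁
... | yes h = h
... | no h with m≤n⇒∃[o]m+o≡n (≮⇒≥ h)
...   | t , eqt = contradiction H (excess⇒≰′ S (cong (λ z → (suc a0 + 1) * (z * P)) eqt) (identity c0 a0 P t P₁))
  where
    S = 2 + P + P * a0 * t + P * c0 + 2 * P * t + 4 * a0 + 3 * a0 * c0 + a0 * a0 + a0 * a0 * c0 + 2 * c0
    identity : ∀ c0 a0 P t P₁ → (suc c0 * P + suc a0) * (suc c0 * suc a0 + suc c0 + 1) + (suc a0 + 1) * ((P₁ + t) * P) ≡
        (suc a0 + 1) * (P₁ * P) + (suc a0 + 1) * ((suc c0 * suc c0) * P) +
        suc (2 + P + P * a0 * t + P * c0 + 2 * P * t + 4 * a0 + 3 * a0 * c0 + a0 * a0 + a0 * a0 * c0 + 2 * c0)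
    identity = solve-∀

c*c<b^L≤b*c⇒b^L≡b : ∀ b .{{_ : NonZero b}} c L → 1 ≤ c → c * c < b ^ L → b ^ L ≤ b * c → b ^ L ≡ b
c*c<b^L≤b*c⇒b^L≡b b c zero          1≤c c*c<1 _ = contradiction (*-mono-≤ 1≤c 1≤c) (<⇒≱ c*c<1)
c*c<b^L≤b*c⇒b^L≡b b c (suc zero)    _   _     _ = *-identityʳ b
c*c<b^L≤b*c⇒b^L≡b b c (suc (suc L)) _   c*c<  ≤bc = contradiction b≤c (<⇒≱ c<b)
  where
    c<b : c < b
    c<b = *-cancelʳ-< c c b (<-≤-trans c*c< ≤bc)
    b≤c : b ≤ c
    b≤c = *-cancelˡ-≤ b (≤-trans (*-monoʳ-≤ b (m≤m*n b (b ^ L) ⦃ m^n≢0 b L ⦄)) ≤bc)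

c≡2×d≡2⊎2d+3<1+b : ∀ c d → 2 ≤ c → 1 ≤ d → 2 * d + 1 ≤ 3 * c → ((c ≡ 2) × (d ≡ 2)) ⊎ (2 * d + 3 < suc (c * c + d))
c≡2×d≡2⊎2d+3<1+b zero d () _ _
c≡2×d≡2⊎2d+3<1+b (suc zero) d (s≤s ()) _ _
c≡2×d≡2⊎2d+3<1+b c zero _ () _
c≡2×d≡2⊎2d+3<1+b (suc (suc zero)) (suc zero) _ _ _ = inj₂ ≤-refl
c≡2×d≡2⊎2d+3<1+b (suc (suc zero)) (suc (suc zero)) _ _ _ = inj₁ (refl , refl)
c≡2×d≡2⊎2d+3<1+b (suc (suc zero)) (suc (suc (suc d′))) _ _ h = contradiction h (<⇒≱ (m+o≡n⇒m≤n (2 * d′) (identity d′)))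
  where
    identity : ∀ d′ → 7 + 2 * d′ ≡ 2 * suc (suc (suc d′)) + 1
    identity = solve-∀
c≡2×d≡2⊎2d+3<1+b c@(suc (suc (suc c1))) d _ _ h1 with 2 * d + 3 <? suc (c * c + d)
... | yes h = inj₂ h
... | no h with m≤n⇒∃[o]m+o≡n h1 | m≤n⇒∃[o]m+o≡n (≮⇒≥ h)
...   | s , eqs | u , equ = contradiction (identity c1 d s u)
  (excess⇒≢ (5 + 9 * c1 + 2 * c1 * c1 + s + 2 * u) (cong₂ (λ x y → 2 * x + y) equ eqs))
  where
    identity : ∀ c1 d s u → 2 * (suc (suc (suc (suc c1)) * suc (suc (suc c1)) + d) + u) + (2 * d + 1 + s) ≡
          2 * (2 * d + 3) + 3 * suc (suc (suc c1)) + suc (5 + 9 * c1 + 2 * c1 * c1 + s + 2 * u)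
    identity = solve-∀

[1+b]^n≡1+b*q : ∀ b n → ∃[ q ] suc b ^ n ≡ 1 + b * q
[1+b]^n≡1+b*q b zero = 0 , cong suc (sym (*-zeroʳ b))
[1+b]^n≡1+b*q b (suc n) with [1+b]^n≡1+b*q b n
... | q , eq = q + (1 + b * q) , trans (cong (suc b *_) eq) (identity b q)
  where
    identity : ∀ b q → suc b * (1 + b * q) ≡ 1 + b * (q + (1 + b * q))
    identity = solve-∀

-- b ≡ -1 modulo b + 1.
b^n≡±1 : ∀ b n → 1 ≤ b → ∃[ p ] ((b ^ n ≡ suc b * p + 1) ⊎ (b ^ n + 1 ≡ suc b * p))
b^n≡±1 (suc b) zero    _ = 0 , inj₁ (sym (cong (_+ 1) (*-zeroʳ (suc (suc b)))))
b^n≡±1 (suc b) (suc n) _ with b^n≡±1 (suc b) n (s≤s z≤n)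
... | p , inj₁ eq = suc b * p + 1 , inj₂ (trans (cong (λ z → suc b * z + 1) eq) (identity b p))
  where
    identity : ∀ b p → suc b * (suc (suc b) * p + 1) + 1 ≡ suc (suc b) * (suc b * p + 1)
    identity = solve-∀
... | zero , inj₂ eq = contradiction (trans (+-comm 1 _) (trans eq (*-zeroʳ (suc (suc b))))) 1+n≢0
... | suc p , inj₂ eq = suc b * p + b , inj₁ (trans (cong (suc b *_) b^n≡) (identity b p))
  where
    b^n≡ : suc b ^ n ≡ suc (suc b) * p + suc b
    b^n≡ = +-cancelʳ-≡ 1 _ _ (trans eq (regroup b p))
      where
        regroup : ∀ b p → suc (suc b) * suc p ≡ suc (suc b) * p + suc b + 1
        regroup = solve-∀
    identity : ∀ b p → suc b * (suc (suc b) * p + suc b) ≡ suc (suc b) * (suc b * p + b) + 1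
    identity = solve-∀

B*x≢B*y+r : ∀ B x y r → 0 < r → r < B → B * x ≢ B * y + r
B*x≢B*y+r B x y r@(suc _) _ r<B eq = >⇒∤ r<B (∣m+n∣m⇒∣n (subst (B ∣_) eq (m∣m*n x)) (m∣m*n y))

X≡Y+j*b : ∀ b X Y α β → X + b * α ≡ Y + b * β → Y < X + b → X < Y + 3 * b → ∃[ j ] j ≤ 2 × X ≡ Y + j * b
X≡Y+j*b b X Y α β eq Y<X+b X<Y+3b with β ≤? α
... | yes β≤α with m≤n⇒∃[o]m+o≡n β≤α
...   | zero , refl = 0 , z≤n ,
  trans (+-cancelʳ-≡ (b * β) _ _ (trans (cong (λ z → X + b * z) (sym (+-identityʳ β))) eq)) (sym (+-identityʳ Y))
...   | suc δ , refl = contradiction Y<X+b (≤⇒≯ (begin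
    X + b             ≤⟨ +-monoʳ-≤ X (m≤m*n b (suc δ)) ⟩
    X + b * suc δ     ≡⟨ +-cancelʳ-≡ (b * β) _ _ (trans (regroup b X δ β) eq) ⟩
    Y                 ∎))
  where
    open ≤-Reasoning
    regroup : ∀ b X δ β → X + b * suc δ + b * β ≡ X + b * (β + suc δ)
    regroup = solve-∀
X≡Y+j*b b X Y α β eq Y<X+b X<Y+3b | no β≰α with m≤n⇒∃[o]m+o≡n (≰⇒> β≰α)
... | δ , refl with +-cancelʳ-≡ (b * α) X (Y + b * suc δ) (trans eq (regroup b Y α δ))
  where
    regroup : ∀ b Y α δ → Y + b * (suc α + δ) ≡ Y + b * suc δ + b * α
    regroup = solve-∀
...   | X≡ with δ
...     | zero        = 1 , s≤s z≤n , trans X≡ (cong (Y +_) (*-comm b 1))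
...     | suc zero    = 2 , ≤-refl , trans X≡ (cong (Y +_) (*-comm b 2))
...     | suc (suc δ′) = contradiction X<Y+3b (≤⇒≯ (begin
    Y + 3 * b                     ≡⟨ cong (Y +_) (*-comm 3 b) ⟩
    Y + b * 3                     ≤⟨ +-monoʳ-≤ Y (*-monoʳ-≤ b (m≤m+n 3 δ′)) ⟩
    Y + b * suc (suc (suc δ′))    ≡⟨ X≡ ⟨
    X                             ∎))
  where open ≤-Reasoning

-- Modulo b + 1 we have Q ≡ 0, b ≡ -1 and P ≡ ±1, which leaves the remainder 2d + 1 + j or 1 + j.
[d+1]Q+j*b≢dP+d+1 : ∀ b d P Q q₁ p₁ j → Q ≡ suc b * q₁ → (P ≡ suc b * p₁ + 1) ⊎ (P + 1 ≡ suc b * p₁) →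
  2 * d + 1 + j < suc b → (d + 1) * Q + j * b ≢ d * P + d + 1
[d+1]Q+j*b≢dP+d+1 b d P Q q₁ p₁ j refl P≡±1 bound eq with P≡±1
... | inj₁ refl = B*x≢B*y+r (suc b) ((d + 1) * q₁ + j) (d * p₁) (2 * d + 1 + j)
  (≤-trans (m≤n+m 1 (2 * d)) (m≤m+n _ j)) bound (begin
    suc b * ((d + 1) * q₁ + j)             ≡⟨ identity₁ b d q₁ j ⟩
    (d + 1) * (suc b * q₁) + j * b + j      ≡⟨ cong (_+ j) eq ⟩
    d * (suc b * p₁ + 1) + d + 1 + j        ≡⟨ identity₂ b d p₁ j ⟩
    suc b * (d * p₁) + (2 * d + 1 + j)      ∎)
  where
    open ≡-Reasoning
    identity₁ : ∀ b d q₁ j → suc b * ((d + 1) * q₁ + j) ≡ (d + 1) * (suc b * q₁) + j * b + j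
    identity₁ = solve-∀
    identity₂ : ∀ b d p₁ j → d * (suc b * p₁ + 1) + d + 1 + j ≡ suc b * (d * p₁) + (2 * d + 1 + j)
    identity₂ = solve-∀
... | inj₂ P+1≡ = B*x≢B*y+r (suc b) ((d + 1) * q₁ + j) (d * p₁) (1 + j)
  (s≤s z≤n) (≤-<-trans (+-monoˡ-≤ j (m≤n+m 1 (2 * d))) bound) (begin
    suc b * ((d + 1) * q₁ + j)             ≡⟨ identity₁ b d q₁ j ⟩
    (d + 1) * (suc b * q₁) + j * b + j      ≡⟨ cong (_+ j) eq ⟩
    d * P + d + 1 + j                       ≡⟨ identity₂ d P j ⟩
    d * (P + 1) + (1 + j)                   ≡⟨ cong (λ z → d * z + (1 + j)) P+1≡ ⟩
    d * (suc b * p₁) + (1 + j)              ≡⟨ identity₃ b d p₁ j ⟩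
    suc b * (d * p₁) + (1 + j)              ∎)
  where
    open ≡-Reasoning
    identity₁ : ∀ b d q₁ j → suc b * ((d + 1) * q₁ + j) ≡ (d + 1) * (suc b * q₁) + j * b + j
    identity₁ = solve-∀
    identity₂ : ∀ d P j → d * P + d + 1 + j ≡ d * (P + 1) + (1 + j)
    identity₂ = solve-∀
    identity₃ : ∀ b d p₁ j → d * (suc b * p₁) + (1 + j) ≡ suc b * (d * p₁) + (1 + j)
    identity₃ = solve-∀

-- Modulo b we have Q ≡ 1 and P ≡ 0, which fixes E′ as E + d + 1 up to a multiple j ≤ 2 of b.
[d+1]Q+E≢dP+E′ : ∀ b d P Q E E′ p₀ q₀ q₁ p₁ →
  Q ≡ 1 + b * q₀ → P ≡ b * p₀ → Q ≡ suc b * q₁ → (P ≡ suc b * p₁ + 1) ⊎ (P + 1 ≡ suc b * p₁) →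
  1 ≤ E → 1 ≤ E′ → E′ ≤ b + d + 1 → E + d < 3 * b → 2 * d + 2 < suc b → (E + d < 2 * b) ⊎ (2 * d + 3 < suc b) →
  (d + 1) * Q + E ≢ d * P + E′
[d+1]Q+E≢dP+E′ b d P Q E E′ p₀ q₀ q₁ p₁ Q≡1 P≡0 Q≡0 P≡±1 1≤E 1≤E′ E′≤ E+d<3b 2d+2<B E+d<2b⊎2d+3<B eq
  with X≡Y+j*b b (E + d + 1) E′ ((d + 1) * q₀) (d * p₀) mod-b E′<X+b X<E′+3b
  where
    open ≡-Reasoning
    identity₁ : ∀ b d q₀ E → (d + 1) * (1 + b * q₀) + E ≡ E + d + 1 + b * ((d + 1) * q₀)
    identity₁ = solve-∀
    identity₂ : ∀ b d p₀ E′ → d * (b * p₀) + E′ ≡ E′ + b * (d * p₀)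
    identity₂ = solve-∀
    mod-b : E + d + 1 + b * ((d + 1) * q₀) ≡ E′ + b * (d * p₀)
    mod-b = begin
      E + d + 1 + b * ((d + 1) * q₀)  ≡⟨ identity₁ b d q₀ E ⟨
      (d + 1) * (1 + b * q₀) + E      ≡⟨ cong (λ z → (d + 1) * z + E) Q≡1 ⟨
      (d + 1) * Q + E                 ≡⟨ eq ⟩
      d * P + E′                      ≡⟨ cong (λ z → d * z + E′) P≡0 ⟩
      d * (b * p₀) + E′               ≡⟨ identity₂ b d p₀ E′ ⟩
      E′ + b * (d * p₀)               ∎
    E′<X+b : E′ < E + d + 1 + b
    E′<X+b = ≤-trans (s≤s E′≤) (m+o≡n⇒m≤n (E ∸ 1) (identity₃ b d E 1≤E))
      where
        identity₃ : ∀ b d E → 1 ≤ E → suc (b + d + 1) + (E ∸ 1) ≡ E + d + 1 + b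
        identity₃ b d (suc e) _ = regroup b d e
          where
            regroup : ∀ b d e → suc (b + d + 1) + e ≡ suc e + d + 1 + b
            regroup = solve-∀
    X<E′+3b : E + d + 1 < E′ + 3 * b
    X<E′+3b = ≤-trans (s≤s (subst (_≤ 3 * b) (sym (+-comm (E + d) 1)) E+d<3b)) (+-monoˡ-≤ (3 * b) 1≤E′)
... | j , j≤2 , X≡ = [d+1]Q+j*b≢dP+d+1 b d P Q q₁ p₁ j Q≡0 P≡±1 (bound j j≤2 X≡) (+-cancelʳ-≡ E′ _ _ (begin
    (d + 1) * Q + j * b + E′        ≡⟨ +-assoc ((d + 1) * Q) (j * b) E′ ⟩
    (d + 1) * Q + (j * b + E′)      ≡⟨ cong ((d + 1) * Q +_) (trans (+-comm (j * b) E′) (sym X≡)) ⟩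
    (d + 1) * Q + (E + d + 1)       ≡⟨ regroup₁ ((d + 1) * Q) E d ⟩
    (d + 1) * Q + E + d + 1         ≡⟨ cong (λ z → z + d + 1) eq ⟩
    d * P + E′ + d + 1              ≡⟨ regroup₂ (d * P) E′ d ⟩
    d * P + d + 1 + E′              ∎))
  where
    open ≡-Reasoning
    regroup₁ : ∀ x E d → x + (E + d + 1) ≡ x + E + d + 1
    regroup₁ = solve-∀
    regroup₂ : ∀ x E′ d → x + E′ + d + 1 ≡ x + d + 1 + E′
    regroup₂ = solve-∀
    2d+1+1<B : 2 * d + 1 + 1 < suc b
    2d+1+1<B = subst (_< suc b) (sym (+-assoc (2 * d) 1 1)) 2d+2<B
    X<E′+2b : E + d < 2 * b → E + d + 1 < E′ + 2 * b
    X<E′+2b E+d<2b = <-≤-trans (+-monoˡ-< 1 E+d<2b) (subst (_≤ E′ + 2 * b) (+-comm 1 (2 * b)) (+-monoˡ-≤ (2 * b) 1≤E′))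
    bound : ∀ j → j ≤ 2 → E + d + 1 ≡ E′ + j * b → 2 * d + 1 + j < suc b
    bound zero             _ _  = ≤-<-trans (+-monoʳ-≤ (2 * d + 1) (z≤n {1})) 2d+1+1<B
    bound (suc zero)       _ _  = 2d+1+1<B
    bound (suc (suc zero)) _ X≡ =
      [ (λ E+d<2b → contradiction X≡ (<⇒≢ (X<E′+2b E+d<2b))) , subst (_< suc b) (sym (+-assoc (2 * d) 1 2)) ]′
      E+d<2b⊎2d+3<B
    bound (suc (suc (suc _))) (s≤s (s≤s ())) _

excess-bounds : ∀ c d A E → 2 ≤ c → 1 ≤ d → let b = c * c + d in
  b ≤ A → 2 * d + 1 ≤ 3 * c → d * A * E ≤ c * c * A + c * E + d * (c + 1) * A + d →
  (E + d < 3 * b) × (2 * d + 2 < suc b) × ((E + d < 2 * b) ⊎ (2 * d + 3 < suc b))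
excess-bounds c d A E 2≤c 1≤d b≤A 2d+1≤3c E-bound with c≡2×d≡2⊎2d+3<1+b c d 2≤c 1≤d 2d+1≤3c
... | inj₁ (refl , refl) = <-≤-trans E+2<2*6 (*-monoˡ-≤ 6 {2} {3} (s≤s (s≤s z≤n))) , ≤-refl , inj₁ E+2<2*6
  where
    E+2<2*6 = E+2<12 A E b≤A E-bound
... | inj₂ 2d+3<B = E+d<3b c d A E 2≤c 1≤d b≤A E-bound , <-trans (+-monoʳ-< (2 * d) (n<1+n 2)) 2d+3<B , inj₂ 2d+3<B

no-excesses : ∀ c d A m m′ E E′ → 2 ≤ c → 1 ≤ d →
  let b = c * c + d ; P = b ^ suc m ; Q = suc b ^ suc m′ in
  b ≤ A → 2 * d + 1 ≤ 3 * c →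
  d * P ≡ c * A + E → (d + 1) * Q ≡ c * A + E′ → 1 ≤ E → 1 ≤ E′ →
  d * A * E ≤ c * c * A + c * E + d * (c + 1) * A + d →
  (d + 1) * A * E′ ≤ c * c * A + c * E′ + (d + 1) * (c + 1) * A + (d + 1) → ⊥
no-excesses c d A m m′ E E′ 2≤c 1≤d b≤A 2d+1≤3c dP≡ [d+1]Q≡ 1≤E 1≤E′ E-bound E′-bound =
  [d+1]Q+E≢dP+E′ b d P Q E E′ (b ^ m) q₀ (suc b ^ m′) p₁ Q≡1+b*q₀ refl refl P≡±1 1≤E 1≤E′
    (E′≤b+d+1 c d A E′ 2≤c 1≤d b≤A E′-bound) (proj₁ bounds) (proj₁ (proj₂ bounds)) (proj₂ (proj₂ bounds)) excess-equation
  where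
    b = c * c + d
    P = b ^ suc m
    Q = suc b ^ suc m′
    Q-mod-b = [1+b]^n≡1+b*q b (suc m′)
    q₀ = proj₁ Q-mod-b
    Q≡1+b*q₀ = proj₂ Q-mod-b
    P-mod-B = b^n≡±1 b (suc m) (≤-trans 1≤d (m≤n+m d (c * c)))
    p₁ = proj₁ P-mod-B
    P≡±1 = proj₂ P-mod-B
    bounds = excess-bounds c d A E 2≤c 1≤d b≤A 2d+1≤3c E-bound
    excess-equation : (d + 1) * Q + E ≡ d * P + E′
    excess-equation = begin
      (d + 1) * Q + E        ≡⟨ cong (_+ E) [d+1]Q≡ ⟩
      c * A + E′ + E         ≡⟨ +-assoc (c * A) E′ E ⟩
      c * A + (E′ + E)       ≡⟨ cong (c * A +_) (+-comm E′ E) ⟩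
      c * A + (E + E′)       ≡⟨ +-assoc (c * A) E E′ ⟨
      c * A + E + E′         ≡⟨ cong (_+ E′) dP≡ ⟨
      d * P + E′             ∎
      where open ≡-Reasoning

no-two-windows-b≤A : ∀ c d A m m′ → 1 ≤ d → 1 ≤ A →
  let b = c * c + d ; P = b ^ suc m ; Q = suc b ^ suc m′ in
  b ≤ A → 2 * d + 1 ≤ 3 * c → A < Q → P ≤ b * A →
  (c * P + A) * (c * A + c + 1) ≤ (A + 1) * (b * P) →
  A * (b * P) ≤ (c * P + A + 1) * (c * A + 1) →
  (c * Q + A) * (c * A + c + 1) ≤ (A + 1) * (suc b * Q) →
  A * (suc b * Q) ≤ (c * Q + A + 1) * (c * A + 1) →
  (c * P + A) * (suc b * Q) ≤ (c * Q + A + 1) * (b * P) → ⊥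
no-two-windows-b≤A zero d A m m′ _ _ _ 2d+1≤0 _ _ _ _ _ _ _ = contradiction (≤-trans (m≤n+m 1 (2 * d)) 2d+1≤0) λ ()
no-two-windows-b≤A (suc zero) zero A m m′ () _ _ _ _ _ _ _ _ _ _
no-two-windows-b≤A (suc zero) (suc zero) A m m′ _ 1≤A _ _ A<Q P≤bA _ _ _ _ cross =
  ¬cross-bound-base2 A (2 ^ suc m) (3 ^ suc m′) 1≤A A<Q P≤bA cross
no-two-windows-b≤A (suc zero) (suc (suc d)) A m m′ _ _ _ 2d+1≤3 _ _ _ _ _ _ _ =
  contradiction (≤-trans (+-monoˡ-≤ 1 (*-monoʳ-≤ 2 (s≤s (s≤s (z≤n {d}))))) 2d+1≤3) (λ { (s≤s (s≤s (s≤s ()))) })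
no-two-windows-b≤A c@(suc (suc _)) d A m m′ 1≤d 1≤A b≤A 2d+1≤3c A<Q P≤bA digits≤cf cf≤digits digits≤cf′ cf≤digits′ _ =
  no-excesses c d A m m′ E E′ (s≤s (s≤s z≤n)) 1≤d b≤A 2d+1≤3c dP≡cA+E [d+1]Q≡cA+E′ 1≤E 1≤E′
    (excess-bound c d A P E cf≤digits dP≡cA+E) (excess-bound c (d + 1) A Q E′ cf≤digits″ [d+1]Q≡cA+E′)
  where
    b = c * c + d
    P = b ^ suc m
    Q = suc b ^ suc m′
    B≡ : suc b ≡ c * c + (d + 1)
    B≡ = sym (+-suc′ (c * c) d)
      where
        +-suc′ : ∀ x d → x + (d + 1) ≡ suc (x + d)
        +-suc′ x d = trans (cong (x +_) (+-comm d 1)) (+-suc x d)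
    digits≤cf″ : (c * Q + A) * (c * A + c + 1) ≤ (A + 1) * ((c * c + (d + 1)) * Q)
    digits≤cf″ = subst (λ z → (c * Q + A) * (c * A + c + 1) ≤ (A + 1) * (z * Q)) B≡ digits≤cf′
    cf≤digits″ : A * ((c * c + (d + 1)) * Q) ≤ (c * Q + A + 1) * (c * A + 1)
    cf≤digits″ = subst (λ z → A * (z * Q) ≤ (c * Q + A + 1) * (c * A + 1)) B≡ cf≤digits′
    E-data = m<n⇒n≡m+o (cA<DR c d A P 1≤A digits≤cf)
    E = proj₁ E-data
    1≤E = proj₁ (proj₂ E-data)
    dP≡cA+E = proj₂ (proj₂ E-data)
    E′-data = m<n⇒n≡m+o (cA<DR c (d + 1) A Q 1≤A digits≤cf″)
    E′ = proj₁ E′-data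
    1≤E′ = proj₁ (proj₂ E′-data)
    [d+1]Q≡cA+E′ = proj₂ (proj₂ E′-data)

no-two-windows : ∀ c d A m m′ → 1 ≤ c → 1 ≤ d → 1 ≤ A →
  let b = c * c + d ; P = b ^ m ; Q = suc b ^ m′ in
  A < P → P ≤ b * A → A < Q →
  (c * P + A) * (c * A + c + 1) ≤ (A + 1) * (b * P) →
  A * (b * P) ≤ (c * P + A + 1) * (c * A + 1) →
  (c * Q + A) * (c * A + c + 1) ≤ (A + 1) * (suc b * Q) →
  A * (suc b * Q) ≤ (c * Q + A + 1) * (c * A + 1) →
  (c * P + A) * (suc b * Q) ≤ (c * Q + A + 1) * (b * P) → ⊥
no-two-windows c d A m zero _ _ 1≤A _ _ A<1 _ _ _ _ _ = contradiction 1≤A (<⇒≱ A<1)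
no-two-windows c d A zero (suc m′) _ _ 1≤A A<1 _ _ _ _ _ _ _ = contradiction 1≤A (<⇒≱ A<1)
no-two-windows c d A (suc zero) (suc m′) 1≤c _ 1≤A _ _ _ _ _ _ _ cross =
  contradiction (≤-trans B≤Q (<⇒≤ Q<P)) (<⇒≱ (s≤s (≤-reflexive (*-identityʳ b))))
  where
    b = c * c + d
    B≤Q : suc b ≤ suc b ^ suc m′
    B≤Q = m≤m*n (suc b) (suc b ^ m′) ⦃ m^n≢0 (suc b) m′ ⦄
    Q<P : suc b ^ suc m′ < b ^ 1
    Q<P = cross-bound⇒Q<P b c A (b ^ 1) (suc b ^ suc m′) 1≤c 1≤A B≤Q cross
no-two-windows c d A (suc (suc m)) (suc m′) 1≤c 1≤d 1≤A _ P≤bA A<Q digits≤cf cf≤digits digits≤cf′ cf≤digits′ cross =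
  no-two-windows-b≤A c d A (suc m) m′ 1≤d 1≤A b≤A d-bound A<Q P≤bA digits≤cf cf≤digits digits≤cf′ cf≤digits′ cross
  where
    b = c * c + d
    instance
      b≢0 : NonZero b
      b≢0 = ℕ.>-nonZero (≤-trans 1≤d (m≤n+m d (c * c)))
    b≤A : b ≤ A
    b≤A = ≤-trans (m≤m*n b (b ^ m) ⦃ m^n≢0 b m ⦄) (*-cancelˡ-≤ b P≤bA)
    2≤A : 2 ≤ A
    2≤A = ≤-trans (+-mono-≤ (*-mono-≤ 1≤c 1≤c) 1≤d) b≤A
    A*B≤ : A * (c * c + d + 1) ≤ (c + 1) * (c * A + 1)
    A*B≤ = subst (λ z → A * z ≤ (c + 1) * (c * A + 1)) (+-comm 1 b)
      (A*B≤[c+1]*[cA+1] (suc b) c A (suc b ^ suc m′) A<Q cf≤digits′)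
    d-bound : 2 * d + 1 ≤ 3 * c
    d-bound = 2d+1≤3c c d A 2≤A A*B≤

-- The base-b expansion of x = [0; c, A, …] begins with the digits of c (a block of length L₁)
-- and then those of A (length L), so x lies in [(c b^L + A) / b^(L₁+L), (c b^L + A + 1) / b^(L₁+L)];
-- the last two fields say this interval meets [A / (cA + 1), (A + 1) / (cA + c + 1)],
-- the interval determined by the first two partial quotients.
record Window (b c A : ℕ) : Set where
  field
    L₁ L         : ℕ
    c<b^L₁       : c < b ^ L₁
    b^L₁≤b*c     : b ^ L₁ ≤ b * c
    A<b^L        : A < b ^ L
    b^L≤b*A      : b ^ L ≤ b * A
    digits≤cf    : (c * b ^ L + A) * (c * A + c + 1) ≤ (A + 1) * (b ^ L₁ * b ^ L)
    cf≤digits    : A * (b ^ L₁ * b ^ L) ≤ (c * b ^ L + A + 1) * (c * A + 1)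

module _ {b c A : ℕ} .{{_ : NonZero b}} (1≤c : 1 ≤ c) (1≤A : 1 ≤ A) (W : Window b c A) where

  open Window W

  c*c<b^L₁ : c * c < b ^ L₁
  c*c<b^L₁ = c*c<P₁ c A (b ^ L) (b ^ L₁) 1≤c 1≤A digits≤cf

  b^L₁≡b : b ^ L₁ ≡ b
  b^L₁≡b = c*c<b^L≤b*c⇒b^L≡b b c L₁ 1≤c c*c<b^L₁ b^L₁≤b*c

no-adjacent-windows : ∀ {b c A} .{{_ : NonZero b}} → 1 ≤ c → 1 ≤ A → (W : Window b c A) (W′ : Window (suc b) c A) →
  let P₁ = b ^ Window.L₁ W ; P = b ^ Window.L W ; Q₁ = suc b ^ Window.L₁ W′ ; Q = suc b ^ Window.L W′ in
  (c * P + A) * (Q₁ * Q) ≤ (c * Q + A + 1) * (P₁ * P) → ⊥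
no-adjacent-windows {b} {c} {A} 1≤c 1≤A W W′ cross =
  leading-blocks-are-b b (b ^ W.L₁) (suc b ^ W′.L₁) (b^L₁≡b 1≤c 1≤A W) (b^L₁≡b 1≤c 1≤A W′) (c*c<b^L₁ 1≤c 1≤A W)
    W.A<b^L W.b^L≤b*A W′.A<b^L W.digits≤cf W.cf≤digits W′.digits≤cf W′.cf≤digits cross
  where
    module W = Window W
    module W′ = Window W′
    leading-blocks-are-b : ∀ b P₁ Q₁ → P₁ ≡ b → Q₁ ≡ suc b → c * c < P₁ →
      let P = b ^ W.L ; Q = suc b ^ W′.L in
      A < P → P ≤ b * A → A < Q →
      (c * P + A) * (c * A + c + 1) ≤ (A + 1) * (P₁ * P) →
      A * (P₁ * P) ≤ (c * P + A + 1) * (c * A + 1) →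
      (c * Q + A) * (c * A + c + 1) ≤ (A + 1) * (Q₁ * Q) →
      A * (Q₁ * Q) ≤ (c * Q + A + 1) * (c * A + 1) →
      (c * P + A) * (Q₁ * Q) ≤ (c * Q + A + 1) * (P₁ * P) → ⊥
    leading-blocks-are-b b .b .(suc b) refl refl c*c<b with m<n⇒n≡m+o c*c<b
    ... | d , 1≤d , refl = no-two-windows c d A W.L W′.L 1≤c 1≤d 1≤A

Window-cong : ∀ {b c c′ A A′} → c ≡ c′ → A ≡ A′ → Window b c A → Window b c′ A′
Window-cong {b} {c} {c′} {A} {A′} c≡c′ A≡A′ W = record
  { L₁ = L₁
  ; L = L
  ; c<b^L₁ = subst (_< b ^ L₁) c≡c′ c<b^L₁
  ; b^L₁≤b*c = subst (λ c → b ^ L₁ ≤ b * c) c≡c′ b^L₁≤b*c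
  ; A<b^L = subst (_< b ^ L) A≡A′ A<b^L
  ; b^L≤b*A = subst (λ A → b ^ L ≤ b * A) A≡A′ b^L≤b*A
  ; digits≤cf = subst₂ (λ c A → (c * b ^ L + A) * (c * A + c + 1) ≤ (A + 1) * (b ^ L₁ * b ^ L)) c≡c′ A≡A′ digits≤cf
  ; cf≤digits = subst₂ (λ c A → A * (b ^ L₁ * b ^ L) ≤ (c * b ^ L + A + 1) * (c * A + 1)) c≡c′ A≡A′ cf≤digits
  }
  where open Window W

convergentFractions : ∀ {a} → Positive a → Fractions (convergent a)
convergentFractions {a} pos = record
  { num = λ j → numer a (3 + j)
  ; den = λ j → denom a (3 + j)
  ; s≡num/den = λ j → refl
  ; den-positive = λ j → 1≤denom pos (3 + j)
  }

module _ {b : ℕ} .{{_ : NonZero b}} (1<b : 1 < b) (a : ℕ → ℕ) where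

  private
    P₁ = b ^ length (digits b (a 0))
    P = b ^ length (digits b (a 1))
    R : ℕ → List ℕ
    R j = concat (map (λ i → digits b (a i)) (applyUpTo (λ i → suc (suc i)) (suc j)))
    W : ℕ → ℕ
    W j = b ^ length (R j)

  digitFractions : Fractions (baseApprox b a)
  digitFractions = record
    { num = λ j → (a 0 * P + a 1) * W j + fromDigits b (R j)
    ; den = λ j → P₁ * (P * W j)
    ; s≡num/den = λ j → baseApprox-suc-suc 1<b a (suc j)
    ; den-positive = λ j → *-mono-≤ (m^n>0 b (length (digits b (a 0))))
                             (*-mono-≤ (m^n>0 b (length (digits b (a 1)))) (m^n>0 b (length (R j))))
    }

  digits-lower : ∀ j → (a 0 * P + a 1) * den digitFractions j ≤ num digitFractions j * (P₁ * P)
  digits-lower j = m+o≡n⇒m≤n (fromDigits b (R j) * (P₁ * P)) (identity (a 0) (a 1) P P₁ (W j) (fromDigits b (R j)))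
    where
      identity : ∀ c A P P₁ W r → (c * P + A) * (P₁ * (P * W)) + r * (P₁ * P) ≡ ((c * P + A) * W + r) * (P₁ * P)
      identity = solve-∀

  digits-upper : ∀ j → num digitFractions j * (P₁ * P) ≤ (a 0 * P + a 1 + 1) * den digitFractions j
  digits-upper j = ≤-from-balance (r * (P₁ * P)) (W j * (P₁ * P)) (identity (a 0) (a 1) P P₁ (W j) r)
      (*-monoˡ-≤ (P₁ * P) (<⇒≤ (fromDigits<b^length 1<b a (applyUpTo (λ i → suc (suc i)) (suc j)))))
    where
      r = fromDigits b (R j)
      identity : ∀ c A P P₁ W r → ((c * P + A) * W + r) * (P₁ * P) + W * (P₁ * P) ≡ (c * P + A + 1) * (P₁ * (P * W)) + r * (P₁ * P)
      identity = solve-∀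

  trott-window : Positive a → SameLimit (convergent a) (baseApprox b a) → Window b (a 0) (a 1)
  trott-window pos cf≈digits = record
    { L₁ = length (digits b (a 0))
    ; L = length (digits b (a 1))
    ; c<b^L₁ = n<b^length-digits 1<b (a 0)
    ; b^L₁≤b*c = b^length-digits≤b*n 1<b (a 0) (pos 0)
    ; A<b^L = n<b^length-digits 1<b (a 1)
    ; b^L≤b*A = b^length-digits≤b*n 1<b (a 1) (pos 1)
    ; digits≤cf = SameLimit⇒≤ (SameLimit-sym {convergent a} {baseApprox b a} cf≈digits) digitFractions (convergentFractions pos)
        (c * P + A) (P₁ * P) (A + 1) (c * A + c + 1) digits-lower (convergent-upper pos)
    ; cf≤digits = SameLimit⇒≤ cf≈digits (convergentFractions pos) digitFractions
        A (c * A + 1) (c * P + A + 1) (P₁ * P) (convergent-lower pos) digits-upper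
    }
    where
      c = a 0
      A = a 1

module _ {a a′ : ℕ → ℕ} (pos : Positive a) (pos′ : Positive a′)
         (a≈a′ : SameLimit (convergent a) (convergent a′)) where

  private
    a′≈a = SameLimit-sym {convergent a} {convergent a′} a≈a′
    S = convergentFractions pos
    S′ = convergentFractions pos′
    c = a 0
    A = a 1
    s = a 2 + 1
    c′ = a′ 0
    A′ = a′ 1
    s′ = a′ 2 + 1

  first-quotients-equal : a′ 0 ≡ a 0
  first-quotients-equal = ≤-antisym
    (leading-quotient-≤ c c′ A A′ (pos 1)
      (SameLimit⇒≤ a≈a′ S S′ A (c * A + 1) (A′ + 1) (c′ * A′ + c′ + 1) (convergent-lower pos) (convergent-upper pos′)))
    (leading-quotient-≤ c′ c A′ A (pos′ 1)
      (SameLimit⇒≤ a′≈a S′ S A′ (c′ * A′ + 1) (A + 1) (c * A + c + 1) (convergent-lower pos′) (convergent-upper pos)))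

  second-quotients-equal : a′ 1 ≡ a 1
  second-quotients-equal = ≤-antisym
    (second-quotient-≤ c A A′ s′
      (subst (λ z → (A′ * s′ + 1) * (c * A + c + 1) ≤ (A + 1) * (z * (A′ * s′ + 1) + s′)) first-quotients-equal
        (SameLimit⇒≤ a′≈a S′ S (A′ * s′ + 1) (c′ * (A′ * s′ + 1) + s′) (A + 1) (c * A + c + 1)
          (convergent-lower-sharp pos′) (convergent-upper pos))))
    (second-quotient-≤ c A′ A s
      (subst (λ z → (A * s + 1) * (z * A′ + z + 1) ≤ (A′ + 1) * (c * (A * s + 1) + s)) first-quotients-equal
        (SameLimit⇒≤ a≈a′ S S′ (A * s + 1) (c * (A * s + 1) + s) (A′ + 1) (c′ * A′ + c′ + 1)
          (convergent-lower-sharp pos) (convergent-upper pos′))))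

module _ {b : ℕ} .{{_ : NonZero b}} (1<b : 1 < b) {a a′ : ℕ → ℕ} (pos : Positive a) (pos′ : Positive a′) where

  digits-cross-bound : SameLimit (convergent a) (baseApprox b a) → SameLimit (convergent a) (convergent a′) →
    SameLimit (convergent a′) (baseApprox (suc b) a′) →
    let P₁ = b ^ length (digits b (a 0)) ; P = b ^ length (digits b (a 1))
        Q₁ = suc b ^ length (digits (suc b) (a′ 0)) ; Q = suc b ^ length (digits (suc b) (a′ 1)) in
    (a 0 * P + a 1) * (Q₁ * Q) ≤ (a′ 0 * Q + a′ 1 + 1) * (P₁ * P)
  digits-cross-bound a≈digits a≈a′ a′≈digits′ =
    EventuallyLe⇒≤ (EventuallyLe-trans digits≲a (EventuallyLe-trans a≲a′ a′≲digits′))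
      (a 0 * P + a 1) (P₁ * P) (a′ 0 * Q + a′ 1 + 1) (Q₁ * Q) (digits-lower 1<b a) (digits-upper (m<n⇒m<1+n 1<b) a′)
    where
      P₁ = b ^ length (digits b (a 0))
      P = b ^ length (digits b (a 1))
      Q₁ = suc b ^ length (digits (suc b) (a′ 0))
      Q = suc b ^ length (digits (suc b) (a′ 1))
      D = digitFractions 1<b a
      D′ = digitFractions (m<n⇒m<1+n 1<b) a′
      S = convergentFractions pos
      S′ = convergentFractions pos′
      digits≲a = SameLimit⇒EventuallyLe (SameLimit-sym {convergent a} {baseApprox b a} a≈digits) D S
      a≲a′ = SameLimit⇒EventuallyLe a≈a′ S S′
      a′≲digits′ = SameLimit⇒EventuallyLe a′≈digits′ S′ D′

proposition6p8 : (k : ℕ) → (a a' : ℕ → ℕ) →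
    IsTrottCF (suc (suc k)) a → IsTrottCF (suc (suc (suc k))) a' →
    SameLimit (convergent a) (convergent a') → ⊥
proposition6p8 k a a′ (pos , a≈digits) (pos′ , a′≈digits′) a≈a′ =
  no-adjacent-windows (pos 0) (pos 1) (trott-window 1<b a pos a≈digits)
    (Window-cong c′≡c A′≡A (trott-window 1<B a′ pos′ a′≈digits′))
    (subst₂ (λ c A → (a 0 * P + a 1) * (Q₁ * Q) ≤ (c * Q + A + 1) * (P₁ * P)) c′≡c A′≡A
      (digits-cross-bound 1<b pos pos′ a≈digits a≈a′ a′≈digits′))
  where
    b = suc (suc k)
    1<b : 1 < b
    1<b = s≤s (s≤s z≤n)
    1<B : 1 < suc b
    1<B = s≤s (s≤s z≤n)
    c′≡c = first-quotients-equal pos pos′ a≈a′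
    A′≡A = second-quotients-equal pos pos′ a≈a′
    P₁ = b ^ length (digits b (a 0))
    P = b ^ length (digits b (a 1))
    Q₁ = suc b ^ length (digits (suc b) (a′ 0))
    Q = suc b ^ length (digits (suc b) (a′ 1))
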